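{- Let $W=\{(0^m),(1^m)\}$ be the repetition code in $H(m,2)$ and let $C$ be a non-trivial (i.e. $C\neq W$) $(X,2)$-neighbour-transitive extension of $W$ with minimum distance $\delta\geq 5$. Then $\mathrm{soc}(X^M)\neq\mathrm{Alt}_m$.
   Context: The Hamming graph $H(m,2)$ has vertex set $\mathbb{F}_2^m$ indexed by entry set $M$ ($|M|=m$), vertices adjacent iff they differ in exactly one entry. For a code $D$, $D_s$ is the set of vertices at distance exactly $s$ from $D$. $\mathrm{Aut}(H(m,2))=B\rtimes L$ with $B\cong\mathrm{Sym}(\{0,1\})^m$ acting coordinatewise and $L\cong\mathrm{Sym}(M)$ permuting entries; $\mathrm{Aut}(C)$ is the setwise stabiliser of $C$. For $X\leq\mathrm{Aut}(C)$, $C$ is $(X,2)$-neighbour-transitive if $X$ is transitive on each of $C$, $C_1$, $C_2$. $K=X\cap B$; $T_W=\{\alpha\mapsto\alpha+w:w\in W\}$; $K_W$ is the setwise stabiliser of $W$ in $K$. An $(X,2)$-neighbour-transitive extension of $W$ is an $(X,2)$-neighbour-transitive code $C$ with $\mathbf{0}\in C$, $T_W\leq X$ and $K=K_W$. $X^M$ is the permutation group induced by $X$ on $M$; $\mathrm{soc}$ denotes the socle (product of minimal normal subgroups) and $\mathrm{Alt}_m$ the alternating group on $M$. -}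

module Defs where

open import Data.Nat using (ℕ; zero; suc; _+_; _<ᵇ_; _≤_)
open import Data.Nat.Divisibility using (_∣_)
open import Data.Bool using (Bool; true; false; _xor_; _∧_; if_then_else_)
open import Data.Fin using (Fin; toℕ)
open import Data.Vec using (Vec; []; _∷_; lookup; tabulate; zipWith; replicate; allFin)
open import Data.Nat.ListAction using (sum)
import Data.Vec as V
open import Data.Product using (Σ; ∃; _×_; _,_)
open import Data.Sum using (_⊎_)
open import Relation.Binary.PropositionalEquality using (_≡_; _≢_)
open import Relation.Nullary using (¬_)

-- The Hamming graph H(m,2): vertices are Vec Bool m (F_2^m, entry set M = Fin m)

Word : ℕ → Set
Word m = Vec Bool m

_⊕_ : ∀ {m} → Word m → Word m → Word m
_⊕_ = zipWith _xor_

zeroW : ∀ m → Word m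
zeroW m = replicate m false

oneW : ∀ m → Word m
oneW m = replicate m true

dist : ∀ {m} → Word m → Word m → ℕ
dist [] [] = 0
dist (x ∷ xs) (y ∷ ys) = (if x xor y then 1 else 0) + dist xs ys

-- Permutations of M = Fin m, represented as vectors (σ i = lookup σ i)

Perm : ℕ → Set
Perm m = Vec (Fin m) m

IsPerm : ∀ {m} → Perm m → Set
IsPerm {m} σ = ∀ (i j : Fin m) → lookup σ i ≡ lookup σ j → i ≡ j

idP : ∀ m → Perm m
idP m = allFin m

_∘P_ : ∀ {m} → Perm m → Perm m → Perm m
σ ∘P τ = tabulate (λ i → lookup σ (lookup τ i))

inversions : ∀ {m} → Perm m → ℕ
inversions {m} σ =
  sum (V.toList (V.map (λ i → sum (V.toList (V.map (λ j →
        if (toℕ i <ᵇ toℕ j) ∧ (toℕ (lookup σ j) <ᵇ toℕ (lookup σ i)) then 1 else 0)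
       (allFin m)))) (allFin m)))

Alt : ∀ m → Perm m → Set
Alt m σ = IsPerm σ × (2 ∣ inversions σ)

IsSubgroup : ∀ {m} → (Perm m → Set) → Set
IsSubgroup {m} H =
  (∀ σ → H σ → IsPerm σ) ×
  H (idP m) ×
  (∀ σ τ → H σ → H τ → H (σ ∘P τ)) ×
  (∀ σ τ → H σ → IsPerm τ → σ ∘P τ ≡ idP m → H τ)

-- N is normal in G: for g ∈ G, n ∈ N, the conjugate h = g n g⁻¹
-- (characterised by h ∘ g = g ∘ n) lies in N
IsNormalIn : ∀ {m} → (Perm m → Set) → (Perm m → Set) → Set
IsNormalIn {m} N G =
  ∀ g n h → G g → N n → IsPerm h → h ∘P g ≡ g ∘P n → N h

IsTrivial : ∀ {m} → (Perm m → Set) → Set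
IsTrivial {m} N = ∀ σ → N σ → σ ≡ idP m

IsNormalSubgroup : ∀ {m} → (Perm m → Set) → (Perm m → Set) → Set
IsNormalSubgroup N G = IsSubgroup N × (∀ σ → N σ → G σ) × IsNormalIn N G

IsMinimalNormal : ∀ {m} → (Perm m → Set) → (Perm m → Set) → Set₁
IsMinimalNormal {m} G N =
  IsNormalSubgroup N G ×
  ¬ IsTrivial N ×
  (∀ (N' : Perm m → Set) → IsNormalSubgroup N' G → (∀ σ → N' σ → N σ) →
     IsTrivial N' ⊎ (∀ σ → N σ → N' σ))

data Gen {m} (S : Perm m → Set₁) : Perm m → Set₁ where
  gen-id  : Gen S (idP m)
  gen-in  : ∀ {σ} → S σ → Gen S σ
  gen-mul : ∀ {σ τ} → Gen S σ → Gen S τ → Gen S (σ ∘P τ)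

Soc : ∀ {m} → (Perm m → Set) → Perm m → Set₁
Soc {m} G = Gen (λ σ → Σ (Perm m → Set) (λ N → IsMinimalNormal G N × N σ))

-- Aut(H(m,2)) = B ⋊ L; an element is (b , σ) acting by
--   α ↦ (α ⊕ b) with entries permuted by σ : (act (b,σ) α)_i = (α ⊕ b)_{σ i}

AutElt : ℕ → Set
AutElt m = Word m × Perm m

act : ∀ {m} → AutElt m → Word m → Word m
act (b , σ) α = tabulate (λ i → lookup (α ⊕ b) (lookup σ i))

IsAutSubgroup : ∀ {m} → (AutElt m → Set) → Set
IsAutSubgroup {m} X =
  (∀ b σ → X (b , σ) → IsPerm σ) ×
  X (zeroW m , idP m) ×
  (∀ g h → X g → X h → ∃ λ k → X k × (∀ α → act k α ≡ act h (act g α))) ×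
  (∀ g → X g → ∃ λ k → X k × (∀ α → act k (act g α) ≡ α))

StabilisesCode : ∀ {m} → (AutElt m → Set) → (Word m → Set) → Set
StabilisesCode {m} X C =
  ∀ g → X g → ∀ α → (C α → C (act g α)) × (C (act g α) → C α)

AtDistance : ∀ {m} → (Word m → Set) → ℕ → Word m → Set
AtDistance C s α = (∃ λ c → C c × dist α c ≡ s) × (∀ c → C c → s ≤ dist α c)

TransitiveOn : ∀ {m} → (AutElt m → Set) → (Word m → Set) → Set
TransitiveOn X S = ∀ α β → S α → S β → ∃ λ g → X g × act g α ≡ β

IsNeighbourTransitive2 : ∀ {m} → (AutElt m → Set) → (Word m → Set) → Set
IsNeighbourTransitive2 X C =
  IsAutSubgroup X × StabilisesCode X C ×
  TransitiveOn X C × TransitiveOn X (AtDistance C 1) × TransitiveOn X (AtDistance C 2)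

InRep : ∀ m → Word m → Set
InRep m α = (α ≡ zeroW m) ⊎ (α ≡ oneW m)

IsExtension2 : ∀ {m} → (AutElt m → Set) → (Word m → Set) → (Word m → Set) → Set
IsExtension2 {m} X W C =
  IsNeighbourTransitive2 X C ×
  C (zeroW m) ×
  (∀ w → W w → X (w , idP m)) ×
  -- K = K_W : every element of K = X ∩ B stabilises W setwise
  (∀ b → X (b , idP m) →
     (∀ w → W w → W (act (b , idP m) w)) × (∀ w → W w → ∃ λ v → W v × act (b , idP m) v ≡ w))

MinDistAtLeast : ∀ {m} → (Word m → Set) → ℕ → Set
MinDistAtLeast C d = ∀ α β → C α → C β → α ≢ β → d ≤ dist α β

InducedOnM : ∀ {m} → (AutElt m → Set) → Perm m → Set
InducedOnM X σ = ∃ λ b → X (b , σ)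

module Submission where

-- We show C = W, so a non-trivial C cannot exist.
--
-- Every 3-cycle σ = (q q+1 q+2) is even, so σ ∈ Alt_m = soc(X^M) ⊆ X^M and
-- some g = (b , σ) lies in X.  Its cube g³ acts trivially on M, hence lies in
-- K = K_W; in particular its translation part d lies in W ⊆ C.  Two words of
-- C that agree outside the three points moved by σ are at distance at most 3,
-- hence equal.  Comparing g(0) with d, and then g(u) with u + d for u ∈ C,
-- this rigidity forces u to be constant on {q, q+1, q+2}.  As q varies the
-- codewords are constant, i.e. C ⊆ W (short lengths m ≤ 2 are handled by the
-- minimum distance alone), and W ⊆ C because T_W ≤ X fixes the code.

open import Defs
open import Data.Nat using (ℕ; zero; suc; _+_; _<ᵇ_; _≤_; _<_; z≤n; s≤s; _≤?_)
open import Data.Nat.Properties using (+-mono-≤; ≤-refl; ≤-trans; ≰⇒>; <⇒≱)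
open import Data.Nat.Divisibility using (divides)
open import Data.Nat.ListAction using (sum)
open import Data.Bool using (Bool; true; false; _xor_; _∧_; if_then_else_; not)
open import Data.Bool.Properties using (xor-same; xor-assoc; xor-identityʳ; not-¬)
import Data.Bool.Properties as Bool
open import Data.Fin using (Fin; toℕ; zero; suc; _≟_)
open import Data.Vec using (Vec; []; _∷_; lookup; tabulate; replicate)
import Data.Vec as V
open import Data.Vec.Properties
  using (lookup∘tabulate; tabulate∘lookup; tabulate-cong; lookup-zipWith; lookup-replicate)
import Data.Vec.Properties as Vec
open import Data.Product using (∃; _×_; _,_; proj₁; proj₂)
open import Data.Sum using (inj₁; inj₂)
open import Data.Empty using (⊥-elim)
open import Relation.Nullary using (¬_; yes; no; does)
open import Relation.Binary.PropositionalEquality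
open ≡-Reasoning

vec-ext : ∀ {A : Set} {n} {xs ys : Vec A n} → (∀ i → lookup xs i ≡ lookup ys i) → xs ≡ ys
vec-ext {xs = xs} {ys} p =
  trans (sym (tabulate∘lookup xs)) (trans (tabulate-cong p) (tabulate∘lookup ys))

xor-cancelʳ : ∀ e {x y} → x xor e ≡ y xor e → x ≡ y
xor-cancelʳ e {x} {y} p = begin
  x                ≡⟨ sym (cancel x) ⟩
  (x xor e) xor e  ≡⟨ cong (_xor e) p ⟩
  (y xor e) xor e  ≡⟨ cancel y ⟩
  y                ∎
  where
  cancel : ∀ z → (z xor e) xor e ≡ z
  cancel z = trans (xor-assoc z e e) (trans (cong (z xor_) (xor-same e)) (xor-identityʳ z))

lookup-act : ∀ {m} (b : Word m) σ α i →
  lookup (act (b , σ) α) i ≡ lookup α (lookup σ i) xor lookup b (lookup σ i)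
lookup-act b σ α i = trans (lookup∘tabulate _ i) (lookup-zipWith _xor_ (lookup σ i) α b)

lookup-idP : ∀ {m} (i : Fin m) → lookup (idP m) i ≡ i
lookup-idP i = lookup∘tabulate (λ j → j) i

lookup-translate : ∀ {m} (w α : Word m) i →
  lookup (act (w , idP m) α) i ≡ lookup α i xor lookup w i
lookup-translate {m} w α i =
  trans (lookup-act w (idP m) α i) (cong (λ j → lookup α j xor lookup w j) (lookup-idP i))

translate-zero : ∀ {m} (w : Word m) → act (w , idP m) (zeroW m) ≡ w
translate-zero {m} w =
  vec-ext (λ i → trans (lookup-translate w (zeroW m) i) (cong (_xor lookup w i) (lookup-replicate i false)))

lookup-act-fixed : ∀ {m} (b : Word m) σ α x → lookup σ x ≡ x →
  lookup (act (b , σ) α) x ≡ lookup α x xor lookup b x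
lookup-act-fixed b σ α x fx =
  trans (lookup-act b σ α x) (cong (λ j → lookup α j xor lookup b j) fx)

IsAffine : ∀ {m} → (Word m → Word m) → (Fin m → Fin m) → (Fin m → Bool) → Set
IsAffine {m} F π e = ∀ α i → lookup (F α) i ≡ lookup α (π i) xor e i

act-affine : ∀ {m} (b : Word m) σ →
  IsAffine (act (b , σ)) (lookup σ) (λ i → lookup b (lookup σ i))
act-affine = lookup-act

act-after-affine : ∀ {m} {F : Word m → Word m} {π e} (b : Word m) σ → IsAffine F π e →
  IsAffine (λ α → act (b , σ) (F α))
           (λ i → π (lookup σ i)) (λ i → e (lookup σ i) xor lookup b (lookup σ i))
act-after-affine {F = F} {π} {e} b σ aff α i =
  trans (lookup-act b σ (F α) i)
    (trans (cong (_xor lookup b (lookup σ i)) (aff α (lookup σ i)))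
           (xor-assoc (lookup α (π (lookup σ i))) _ _))

unit : ∀ {m} → Fin m → Word m
unit j = tabulate (λ z → does (z ≟ j))

lookup-unit-self : ∀ {m} (j : Fin m) → lookup (unit j) j ≡ true
lookup-unit-self j with j ≟ j in eq
... | yes _ = trans (lookup∘tabulate _ j) (cong does eq)
... | no j≢j = ⊥-elim (j≢j refl)

lookup-unit-other : ∀ {m} {z j : Fin m} → ¬ z ≡ j → lookup (unit j) z ≡ false
lookup-unit-other {z = z} {j} z≢j with z ≟ j in eq
... | yes z≡j = ⊥-elim (z≢j z≡j)
... | no _ = trans (lookup∘tabulate _ z) (cong does eq)

-- The linear part of an affine map is determined by the map: evaluating at 0
-- recovers the translation, evaluating at a unit vector then separates π i.
affine-unique : ∀ {m} {F : Word m → Word m} {π π' e e'} →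
  IsAffine F π e → IsAffine F π' e' → ∀ i → π i ≡ π' i
affine-unique {m} {F} {π} {π'} {e} {e'} aff aff' i with π i ≟ π' i
... | yes same = same
... | no differ = ⊥-elim (not-¬ refl (trans (sym atZero) atUnit))
  where
  atZero : e i ≡ e' i
  atZero = begin
    e i                                   ≡⟨ cong (_xor e i) (sym (lookup-replicate (π i) false)) ⟩
    lookup (zeroW m) (π i) xor e i        ≡⟨ sym (aff (zeroW m) i) ⟩
    lookup (F (zeroW m)) i                ≡⟨ aff' (zeroW m) i ⟩
    lookup (zeroW m) (π' i) xor e' i      ≡⟨ cong (_xor e' i) (lookup-replicate (π' i) false) ⟩
    e' i                                  ∎
  atUnit : e i ≡ not (e' i)
  atUnit = begin
    e i                                   ≡⟨ cong (_xor e i) (sym (lookup-unit-other differ)) ⟩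
    lookup (unit (π' i)) (π i) xor e i    ≡⟨ sym (aff (unit (π' i)) i) ⟩
    lookup (F (unit (π' i))) i            ≡⟨ aff' (unit (π' i)) i ⟩
    lookup (unit (π' i)) (π' i) xor e' i  ≡⟨ cong (_xor e' i) (lookup-unit-self (π' i)) ⟩
    not (e' i)                            ∎

perm-of-product : ∀ {m} (g h k : AutElt m) → (∀ α → act k α ≡ act h (act g α)) →
  proj₂ k ≡ proj₂ g ∘P proj₂ h
perm-of-product (b , σ) (b' , τ) (b'' , ρ) k≈hg = vec-ext λ i →
  trans (affine-unique {F = act (b'' , ρ)} (act-affine b'' ρ) composite i) (sym (lookup∘tabulate _ i))
  where
  composite : IsAffine (act (b'' , ρ)) (λ i → lookup σ (lookup τ i))
                       (λ i → lookup b (lookup σ (lookup τ i)) xor lookup b' (lookup τ i))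
  composite α i = trans (cong (λ v → lookup v i) (k≈hg α))
                        (act-after-affine {F = act (b , σ)} b' τ (act-affine b σ) α i)

induced-closed : ∀ {m} (X : AutElt m → Set) → IsAutSubgroup X → ∀ σ τ →
  InducedOnM X σ → InducedOnM X τ → InducedOnM X (σ ∘P τ)
induced-closed X (_ , _ , closed , _) σ τ (b , Xg) (b' , Xh)
  with closed (b , σ) (b' , τ) Xg Xh
... | ((b'' , ρ) , Xk , k≈hg) =
  b'' , subst (λ π → X (b'' , π)) (perm-of-product (b , σ) (b' , τ) (b'' , ρ) k≈hg) Xk

soc⊆ : ∀ {m} (G : Perm m → Set) → G (idP m) → (∀ σ τ → G σ → G τ → G (σ ∘P τ)) →
  ∀ σ → Soc G σ → G σ
soc⊆ G id∈G closed _ gen-id = id∈G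
soc⊆ G id∈G closed σ (gen-in (N , ((_ , N⊆G , _) , _ , _) , Nσ)) = N⊆G σ Nσ
soc⊆ G id∈G closed _ (gen-mul {σ} {τ} sσ sτ) =
  closed σ τ (soc⊆ G id∈G closed σ sσ) (soc⊆ G id∈G closed τ sτ)

-- cycle3 q is the 3-cycle q ↦ q+1 ↦ q+2 ↦ q on Fin m (the identity if q + 3 > m).
cycle3 : ℕ → ∀ {m} → Fin m → Fin m
cycle3 zero {suc zero} x = x
cycle3 zero {suc (suc zero)} x = x
cycle3 zero {suc (suc (suc m))} zero = suc zero
cycle3 zero {suc (suc (suc m))} (suc zero) = suc (suc zero)
cycle3 zero {suc (suc (suc m))} (suc (suc zero)) = zero
cycle3 zero {suc (suc (suc m))} (suc (suc (suc x))) = suc (suc (suc x))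
cycle3 (suc q) {suc m} zero = zero
cycle3 (suc q) {suc m} (suc x) = suc (cycle3 q x)

cycle3-cube : ∀ q {m} (x : Fin m) → cycle3 q (cycle3 q (cycle3 q x)) ≡ x
cycle3-cube zero {suc zero} x = refl
cycle3-cube zero {suc (suc zero)} x = refl
cycle3-cube zero {suc (suc (suc m))} zero = refl
cycle3-cube zero {suc (suc (suc m))} (suc zero) = refl
cycle3-cube zero {suc (suc (suc m))} (suc (suc zero)) = refl
cycle3-cube zero {suc (suc (suc m))} (suc (suc (suc x))) = refl
cycle3-cube (suc q) {suc m} zero = refl
cycle3-cube (suc q) {suc m} (suc x) = cong suc (cycle3-cube q x)

cyc : ∀ {m} → ℕ → Perm m
cyc q = tabulate (cycle3 q)

lookup-cyc : ∀ {m} q (x : Fin m) → lookup (cyc q) x ≡ cycle3 q x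
lookup-cyc q x = lookup∘tabulate (cycle3 q) x

cyc-cube : ∀ {m} q → (cyc {m} q ∘P cyc q) ∘P cyc q ≡ idP m
cyc-cube {m} q = vec-ext λ i → begin
  lookup ((σ ∘P σ) ∘P σ) i            ≡⟨ lookup∘tabulate (λ j → lookup (σ ∘P σ) (lookup σ j)) i ⟩
  lookup (σ ∘P σ) (lookup σ i)        ≡⟨ lookup∘tabulate (λ j → lookup σ (lookup σ j)) (lookup σ i) ⟩
  lookup σ (lookup σ (lookup σ i))    ≡⟨ lookup-cyc q _ ⟩
  cycle3 q (lookup σ (lookup σ i))    ≡⟨ cong (cycle3 q) (lookup-cyc q _) ⟩
  cycle3 q (cycle3 q (lookup σ i))    ≡⟨ cong (λ j → cycle3 q (cycle3 q j)) (lookup-cyc q i) ⟩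
  cycle3 q (cycle3 q (cycle3 q i))    ≡⟨ cycle3-cube q i ⟩
  i                                   ≡⟨ sym (lookup-idP i) ⟩
  lookup (idP m) i                    ∎
  where
  σ : Perm m
  σ = cyc q

∑ : (n : ℕ) → (Fin n → ℕ) → ℕ
∑ zero f = 0
∑ (suc n) f = f zero + ∑ n (λ i → f (suc i))

∑-cong : ∀ n {f g : Fin n → ℕ} → (∀ i → f i ≡ g i) → ∑ n f ≡ ∑ n g
∑-cong zero p = refl
∑-cong (suc n) p = cong₂ _+_ (p zero) (∑-cong n (λ i → p (suc i)))

∑-zero : ∀ n → ∑ n (λ _ → 0) ≡ 0
∑-zero zero = refl
∑-zero (suc n) = ∑-zero n

sum-tabulate : ∀ {A : Set} n (f : A → ℕ) (g : Fin n → A) →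
  sum (V.toList (V.map f (tabulate g))) ≡ ∑ n (λ i → f (g i))
sum-tabulate zero f g = refl
sum-tabulate (suc n) f g = cong (f (g zero) +_) (sum-tabulate n f (λ i → g (suc i)))

inversionCount : ∀ m → (Fin m → Fin m) → ℕ
inversionCount m g = ∑ m λ i → ∑ m λ j →
  if (toℕ i <ᵇ toℕ j) ∧ (toℕ (g j) <ᵇ toℕ (g i)) then 1 else 0

inversions-tabulate : ∀ m (g : Fin m → Fin m) → inversions (tabulate g) ≡ inversionCount m g
inversions-tabulate m g = trans (sum-tabulate m _ (λ i → i))
  (∑-cong m λ i → trans (sum-tabulate m _ (λ j → j))
    (∑-cong m λ j → cong₂ (λ a b → if (toℕ i <ᵇ toℕ j) ∧ (toℕ a <ᵇ toℕ b) then 1 else 0)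
                           (lookup∘tabulate g j) (lookup∘tabulate g i)))

-- No two naturals are each smaller than the other: entries fixed by the
-- 3-cycle form no inversions.
<ᵇ-asym : ∀ a b → ((a <ᵇ b) ∧ (b <ᵇ a)) ≡ false
<ᵇ-asym zero zero = refl
<ᵇ-asym zero (suc b) = refl
<ᵇ-asym (suc a) zero = refl
<ᵇ-asym (suc a) (suc b) = <ᵇ-asym a b

-- (0 1 2) has exactly the two inversions (0,2) and (1,2); a fixed leading
-- entry contributes none.
inversionCount-cycle3 : ∀ q m → q + 3 ≤ m → inversionCount m (cycle3 q) ≡ 2
inversionCount-cycle3 zero (suc (suc (suc m))) _ =
  cong₂ (λ a b → (1 + a) + ((1 + a) + (a + b))) (∑-zero m)
    (trans (∑-cong m λ i → trans (∑-cong m λ j → cong (λ c → if c then 1 else 0) (<ᵇ-asym (toℕ i) (toℕ j)))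
                                 (∑-zero m))
           (∑-zero m))
inversionCount-cycle3 zero (suc zero) (s≤s ())
inversionCount-cycle3 zero (suc (suc zero)) (s≤s (s≤s ()))
inversionCount-cycle3 (suc q) (suc m) (s≤s le) =
  trans (cong (_+ inversionCount m (cycle3 q)) (∑-zero m)) (inversionCount-cycle3 q m le)

cyc-even : ∀ {m} q → q + 3 ≤ m → Alt m (cyc q)
cyc-even {m} q le = injective , divides 1 (trans (inversions-tabulate m (cycle3 q)) (inversionCount-cycle3 q m le))
  where
  injective : IsPerm (cyc q)
  injective i j eq = begin
    i                                 ≡⟨ sym (cycle3-cube q i) ⟩
    cycle3 q (cycle3 q (cycle3 q i))  ≡⟨ cong (λ z → cycle3 q (cycle3 q z)) (trans (sym (lookup-cyc q i)) (trans eq (lookup-cyc q j))) ⟩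
    cycle3 q (cycle3 q (cycle3 q j))  ≡⟨ cycle3-cube q j ⟩
    j                                 ∎

indicator≤1 : ∀ b → (if b then 1 else 0) ≤ 1
indicator≤1 true = ≤-refl
indicator≤1 false = z≤n

dist-self : ∀ {m} (a : Word m) → dist a a ≡ 0
dist-self [] = refl
dist-self (x ∷ a) rewrite xor-same x = dist-self a

dist≤length : ∀ {m} (a b : Word m) → dist a b ≤ m
dist≤length [] [] = z≤n
dist≤length (x ∷ a) (y ∷ b) = +-mono-≤ (indicator≤1 (x xor y)) (dist≤length a b)

AgreeOff : ∀ {m} → ℕ → Word m → Word m → Set
AgreeOff {m} q a b = ∀ x → cycle3 q x ≡ x → lookup a x ≡ lookup b x

dist-agreeOff : ∀ q {m} → q + 3 ≤ m → (a b : Word m) → AgreeOff q a b → dist a b ≤ 3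
dist-agreeOff zero {suc (suc (suc m))} _ (a₀ ∷ a₁ ∷ a₂ ∷ a) (b₀ ∷ b₁ ∷ b₂ ∷ b) agree
  rewrite vec-ext {xs = a} {b} (λ x → agree (suc (suc (suc x))) refl) | dist-self b =
  +-mono-≤ (indicator≤1 (a₀ xor b₀)) (+-mono-≤ (indicator≤1 (a₁ xor b₁)) (+-mono-≤ (indicator≤1 (a₂ xor b₂)) z≤n))
dist-agreeOff zero {suc zero} (s≤s ()) _ _ _
dist-agreeOff zero {suc (suc zero)} (s≤s (s≤s ())) _ _ _
dist-agreeOff (suc q) {suc m} (s≤s le) (a₀ ∷ a) (b₀ ∷ b) agree
  rewrite agree zero refl | xor-same b₀ = dist-agreeOff q le a b (λ x fx → agree (suc x) (cong suc fx))

minDist-weaken : ∀ {m} {C : Word m → Set} {d d'} → d ≤ d' → MinDistAtLeast C d' → MinDistAtLeast C d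
minDist-weaken d≤d' md α β cα cβ α≢β = ≤-trans d≤d' (md α β cα cβ α≢β)

short-code : ∀ {m} {C : Word m → Set} {d} → m < d → MinDistAtLeast C d →
  C (zeroW m) → ∀ u → C u → u ≡ zeroW m
short-code {m} m<d md c0 u cu with Vec.≡-dec Bool._≟_ u (zeroW m)
... | yes u≡0 = u≡0
... | no u≢0 = ⊥-elim (<⇒≱ m<d (≤-trans (md u (zeroW m) cu c0 u≢0) (dist≤length u (zeroW m))))

InvariantUnder3Cycles : ∀ {m} → Word m → Set
InvariantUnder3Cycles {m} u = ∀ q → q + 3 ≤ m → ∀ x → lookup u (cycle3 q x) ≡ lookup u x

constant-inRep : ∀ m a → InRep m (replicate m a)
constant-inRep m true = inj₂ refl
constant-inRep m false = inj₁ refl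

-- Consecutive 3-cycles force consecutive entries to be equal.
invariant-constant : ∀ {n} (u : Word (3 + n)) → InvariantUnder3Cycles u →
  u ≡ replicate (3 + n) (lookup u zero)
invariant-constant (a ∷ b ∷ c ∷ []) inv =
  cong (a ∷_) (cong₂ _∷_ b≡a (cong (_∷ []) (trans c≡b b≡a)))
  where
  b≡a = inv 0 ≤-refl zero
  c≡b = inv 0 ≤-refl (suc zero)
invariant-constant {suc n} (a ∷ b ∷ c ∷ d ∷ v) inv =
  cong (a ∷_) (trans tail-constant (cong (replicate (3 + n)) b≡a))
  where
  b≡a = inv 0 (s≤s (s≤s (s≤s z≤n))) zero
  tail-constant : b ∷ c ∷ d ∷ v ≡ replicate (3 + n) b
  tail-constant = invariant-constant (b ∷ c ∷ d ∷ v) (λ q le x → inv (suc q) (s≤s le) (suc x))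

invariant-inRep : ∀ {m} (u : Word m) → 3 ≤ m → InvariantUnder3Cycles u → InRep m u
invariant-inRep {suc zero} u (s≤s ()) inv
invariant-inRep {suc (suc zero)} u (s≤s (s≤s ())) inv
invariant-inRep {suc (suc (suc n))} u _ inv
  rewrite invariant-constant u inv = constant-inRep _ _

module RepetitionExtension {m} (X : AutElt m → Set) (C : Word m → Set)
  (ext : IsExtension2 X (InRep m) C) (md : MinDistAtLeast C 4)
  (cycInduced : ∀ q → q + 3 ≤ m → InducedOnM X (cyc q)) where

  private
    aut : IsAutSubgroup X
    aut = proj₁ (proj₁ ext)
    stabilises : StabilisesCode X C
    stabilises = proj₁ (proj₂ (proj₁ ext))
    zero∈C : C (zeroW m)
    zero∈C = proj₁ (proj₂ ext)
    TW≤X : ∀ w → InRep m w → X (w , idP m)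
    TW≤X = proj₁ (proj₂ (proj₂ ext))
    K=KW : ∀ b → X (b , idP m) → ∀ w → InRep m w → InRep m (act (b , idP m) w)
    K=KW b Xb = proj₁ (proj₂ (proj₂ (proj₂ ext)) b Xb)
    closed : ∀ g h → X g → X h → ∃ λ k → X k × (∀ α → act k α ≡ act h (act g α))
    closed = proj₁ (proj₂ (proj₂ aut))

  C-closed : ∀ g → X g → ∀ u → C u → C (act g u)
  C-closed g Xg u cu = proj₁ (stabilises g Xg u) cu

  -- W ⊆ C, as T_W ≤ X stabilises C and 0 ∈ C.
  W⊆C : ∀ w → InRep m w → C w
  W⊆C w w∈W = subst C (translate-zero w) (C-closed (w , idP m) (TW≤X w w∈W) (zeroW m) zero∈C)

  rigid : ∀ q → q + 3 ≤ m → ∀ a b → C a → C b → AgreeOff q a b → a ≡ b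
  rigid q le a b ca cb agree with Vec.≡-dec Bool._≟_ a b
  ... | yes a≡b = a≡b
  ... | no a≢b = ⊥-elim (four≰three (≤-trans (md a b ca cb a≢b) (dist-agreeOff q le a b agree)))
    where
    four≰three : ¬ 4 ≤ 3
    four≰three (s≤s (s≤s (s≤s ())))

  cube-translation : ∀ q b → X (b , cyc q) →
    ∃ λ d → InRep m d × AgreeOff q d b × (∀ α → act (d , idP m) α ≡ act (b , cyc q) (act (b , cyc q) (act (b , cyc q) α)))
  cube-translation q b Xg with closed (b , cyc q) (b , cyc q) Xg Xg
  ... | (g² , Xg² , g²≈) with closed g² (b , cyc q) Xg² Xg
  ... | ((d , ρ) , Xg³ , g³≈) = d , d∈W , agree , acts
    where
    g : AutElt m
    g = (b , cyc q)
    acts′ : ∀ α → act (d , ρ) α ≡ act g (act g (act g α))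
    acts′ α = trans (g³≈ α) (cong (act g) (g²≈ α))
    ρ≡id : ρ ≡ idP m
    ρ≡id = begin
      ρ                         ≡⟨ perm-of-product g² g (d , ρ) g³≈ ⟩
      proj₂ g² ∘P cyc q         ≡⟨ cong (_∘P cyc q) (perm-of-product g g g² g²≈) ⟩
      (cyc q ∘P cyc q) ∘P cyc q ≡⟨ cyc-cube q ⟩
      idP m                     ∎
    acts : ∀ α → act (d , idP m) α ≡ act g (act g (act g α))
    acts α = trans (cong (λ π → act (d , π) α) (sym ρ≡id)) (acts′ α)
    d∈W : InRep m d
    d∈W = subst (InRep m) (translate-zero d)
      (K=KW d (subst (λ π → X (d , π)) ρ≡id Xg³) (zeroW m) (inj₁ refl))
    agree : AgreeOff q d b
    agree x fx = begin
      lookup d x                                   ≡⟨ cong (λ w → lookup w x) (sym (translate-zero d)) ⟩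
      lookup (act (d , idP m) (zeroW m)) x         ≡⟨ cong (λ w → lookup w x) (acts (zeroW m)) ⟩
      lookup (act g (act g (act g (zeroW m)))) x   ≡⟨ step (act g (act g (zeroW m))) ⟩
      lookup (act g (act g (zeroW m))) x xor bₓ    ≡⟨ cong (_xor bₓ) (step (act g (zeroW m))) ⟩
      (lookup (act g (zeroW m)) x xor bₓ) xor bₓ   ≡⟨ cong (λ z → (z xor bₓ) xor bₓ) (step (zeroW m)) ⟩
      ((lookup (zeroW m) x xor bₓ) xor bₓ) xor bₓ  ≡⟨ cong (λ z → ((z xor bₓ) xor bₓ) xor bₓ) (lookup-replicate x false) ⟩
      (bₓ xor bₓ) xor bₓ                           ≡⟨ cong (_xor bₓ) (xor-same bₓ) ⟩
      bₓ                                           ∎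
      where
      bₓ : Bool
      bₓ = lookup b x
      step : ∀ α → lookup (act g α) x ≡ lookup α x xor bₓ
      step α = lookup-act-fixed b (cyc q) α x (trans (lookup-cyc q x) fx)

  codeword-invariant : ∀ u → C u → InvariantUnder3Cycles u
  codeword-invariant u cu q le x with cycInduced q le
  ... | (b , Xg) with cube-translation q b Xg
  ... | (d , d∈W , d≈b , acts) = xor-cancelʳ bσx (begin
    lookup u (cycle3 q x) xor bσx
      ≡⟨ trans (cong (λ y → lookup u y xor lookup b y) (sym σx)) (sym (lookup-act b (cyc q) u x)) ⟩
    lookup (act g u) x                   ≡⟨ cong (λ w → lookup w x) gu≡u+d ⟩
    lookup (act (d , idP m) u) x         ≡⟨ lookup-translate d u x ⟩
    lookup u x xor lookup d x            ≡⟨ cong (λ w → lookup u x xor lookup w x) (sym g0≡d) ⟩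
    lookup u x xor lookup (act g (zeroW m)) x
      ≡⟨ cong (lookup u x xor_) (trans (lookup-act b (cyc q) (zeroW m) x) (cong₂ _xor_ (lookup-replicate (lookup (cyc q) x) false) (cong (lookup b) σx))) ⟩
    lookup u x xor bσx                   ∎)
    where
    g : AutElt m
    g = (b , cyc q)
    σx : lookup (cyc q) x ≡ cycle3 q x
    σx = lookup-cyc q x
    bσx : Bool
    bσx = lookup b (cycle3 q x)
    fixed : ∀ y → cycle3 q y ≡ y → lookup (cyc q) y ≡ y
    fixed y fy = trans (lookup-cyc q y) fy
    -- g(0) and d are codewords agreeing off the 3-cycle.
    g0≡d : act g (zeroW m) ≡ d
    g0≡d = rigid q le _ d (C-closed g Xg (zeroW m) zero∈C) (W⊆C d d∈W)
      (λ y fy → trans (lookup-act-fixed b (cyc q) (zeroW m) y (fixed y fy))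
                      (trans (cong (_xor lookup b y) (lookup-replicate y false)) (sym (d≈b y fy))))
    -- g(u) and u + d are codewords agreeing off the 3-cycle.
    gu≡u+d : act g u ≡ act (d , idP m) u
    gu≡u+d = rigid q le _ _ (C-closed g Xg u cu) (C-closed (d , idP m) (TW≤X d d∈W) u cu)
      (λ y fy → trans (lookup-act-fixed b (cyc q) u y (fixed y fy))
                      (trans (cong (lookup u y xor_) (sym (d≈b y fy))) (sym (lookup-translate d u y))))

  -- C ⊆ W: for m ≤ 2 by the minimum distance alone, otherwise because
  -- codewords are invariant under all the 3-cycles.
  C⊆W : ∀ u → C u → InRep m u
  C⊆W u cu with m ≤? 2
  ... | yes m≤2 = inj₁ (short-code (s≤s (≤-trans m≤2 (s≤s (s≤s z≤n)))) md zero∈C u cu)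
  ... | no m≰2 = invariant-inRep u (≰⇒> m≰2) (codeword-invariant u cu)

lemma3p7 : (m : ℕ) (X : AutElt m → Set) (C : Word m → Set) →
    IsExtension2 X (InRep m) C →
    ¬ (∀ α → (C α → InRep m α) × (InRep m α → C α)) →
    MinDistAtLeast C 5 →
    ¬ (∀ σ → (Soc (InducedOnM X) σ → Alt m σ) × (Alt m σ → Soc (InducedOnM X) σ))
lemma3p7 m X C ext nontrivial md soc≡Alt =
  nontrivial (λ α → C⊆W α , W⊆C α)
  where
  aut : IsAutSubgroup X
  aut = proj₁ (proj₁ ext)
  -- Alt_m = soc(X^M) ⊆ X^M, so X^M contains every 3-cycle (q q+1 q+2).
  cycInduced : ∀ q → q + 3 ≤ m → InducedOnM X (cyc q)
  cycInduced q le =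
    soc⊆ (InducedOnM X) (zeroW m , proj₁ (proj₂ aut)) (induced-closed X aut)
         (cyc q) (proj₂ (soc≡Alt (cyc q)) (cyc-even q le))
  open RepetitionExtension X C ext (minDist-weaken (s≤s (s≤s (s≤s (s≤s z≤n)))) md) cycInduced
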